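{- A permutation $p=p_1\cdots p_n$ avoids both dashed patterns $32$-$41$ and $41$-$32$ if and only if the sequence of its descent initiators (read left to right) is order isomorphic to the sequence of its descent terminators (read left to right).
   Context: A descent of $p$ is a pair of consecutive entries $p_ip_{i+1}$ with $p_i>p_{i+1}$; $p_i$ is its descent initiator and $p_{i+1}$ its descent terminator. Two sequences $(x_1,\dots,x_m)$, $(y_1,\dots,y_m)$ of distinct numbers are order isomorphic if $x_s<x_t \iff y_s<y_t$ for all $s,t$. The permutation $p$ contains the dashed pattern $32$-$41$ if there are indices $i,j$ with $i+2\le j\le n-1$ and $p_{j+1}<p_{i+1}<p_i<p_j$; it contains $41$-$32$ if there are indices $i,j$ with $i+2\le j\le n-1$ and $p_{i+1}<p_{j+1}<p_j<p_i$; it avoids a pattern if it does not contain it. -}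

module Defs where

open import Data.Nat using (ℕ; zero; suc; _+_; _<_; _≤_)
open import Data.Fin using (Fin; toℕ; cast)
open import Data.List using (List; []; _∷_; length; map; lookup)
open import Data.Vec using (tabulate; toList)
open import Data.Product using (Σ; _×_; _,_; proj₁; proj₂; ∃-syntax)
open import Relation.Nullary using (¬_; yes; no)
open import Relation.Binary.PropositionalEquality using (_≡_)
open import Function using (Injective; _∘_)

-- A permutation of length n: an injective map Fin n → Fin n
-- (positions 0..n-1 ↦ values 0..n-1; 0-based versions of 1..n).
record Perm (n : ℕ) : Set where
  field
    fun : Fin n → Fin n
    inj : Injective _≡_ _≡_ fun
open Perm public

word : ∀ {n} → Perm n → List ℕ
word p = toList (tabulate (toℕ ∘ fun p))

-- descents (initiator, terminator) of a word, read left to right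
-- descentsFrom x ys: descents of the word x ∷ ys
descentsFrom : ℕ → List ℕ → List (ℕ × ℕ)
descentsFrom x [] = []
descentsFrom x (y ∷ ys) with y Data.Nat.<? x
... | yes _ = (x , y) ∷ descentsFrom y ys
... | no  _ = descentsFrom y ys

descentPairs : List ℕ → List (ℕ × ℕ)
descentPairs [] = []
descentPairs (x ∷ xs) = descentsFrom x xs

descentInitiators : ∀ {n} → Perm n → List ℕ
descentInitiators p = map proj₁ (descentPairs (word p))

descentTerminators : ∀ {n} → Perm n → List ℕ
descentTerminators p = map proj₂ (descentPairs (word p))

OrderIsomorphic : List ℕ → List ℕ → Set
OrderIsomorphic xs ys =
  Σ (length xs ≡ length ys) λ e →
    (s t : Fin (length xs)) →
      (lookup xs s < lookup xs t → lookup ys (cast e s) < lookup ys (cast e t))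
    × (lookup ys (cast e s) < lookup ys (cast e t) → lookup xs s < lookup xs t)

-- p contains 32-41: 1-based indices i, j with i+2 ≤ j ≤ n-1 and
-- p_{j+1} < p_{i+1} < p_i < p_j.  In 0-based positions: i, i', j, j'
-- with i' = i+1, j' = j+1 (j' a valid position) and i+2 ≤ j.
Contains32-41 : ∀ {n} → Perm n → Set
Contains32-41 {n} p =
  ∃[ i ] ∃[ i' ] ∃[ j ] ∃[ j' ]
    (toℕ i' ≡ suc (toℕ i)) × (toℕ j' ≡ suc (toℕ j)) × (toℕ i + 2 ≤ toℕ j)
    × (v j' < v i') × (v i' < v i) × (v i < v j)
  where v : Fin n → ℕ
        v = toℕ ∘ fun p

Contains41-32 : ∀ {n} → Perm n → Set
Contains41-32 {n} p =
  ∃[ i ] ∃[ i' ] ∃[ j ] ∃[ j' ]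
    (toℕ i' ≡ suc (toℕ i)) × (toℕ j' ≡ suc (toℕ j)) × (toℕ i + 2 ≤ toℕ j)
    × (v i' < v j') × (v j' < v j) × (v j < v i)
  where v : Fin n → ℕ
        v = toℕ ∘ fun p

module Submission where

-- Call two descents (a , b) and (c , d) (initiator, terminator) crossing
-- when a < c but d < b.  Both sides of the theorem say that p has no
-- crossing pair of descents:
--  * For any list of pairs in which a first component determines its second
--    component and vice versa, the list of first components is order
--    isomorphic to the list of second components iff no two members cross.
--    Descents of a permutation satisfy this, its entries being distinct.
--  * Two crossing descents at positions i and j are never adjacent
--    (j = i + 1 would force b = c, hence a < c = b < a), so they are at
--    distance at least two, and the values d < b < a < c form the pattern
--    32-41 when (a , b) comes first and 41-32 when it comes second.

open import Defs
open import Data.Nat using (ℕ; zero; suc; _+_; _<_; _≤_; _<?_)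
open import Data.Nat.Properties using (<-cmp; <-irrefl; <-asym; <-trans; ≤∧≢⇒<; +-comm; suc-injective)
open import Data.Fin using (Fin; toℕ; cast) renaming (zero to fzero; suc to fsuc)
open import Data.Fin.Properties using (toℕ-injective)
open import Data.List using (List; _∷_; length; map; lookup)
open import Data.List.Properties using (length-map)
open import Data.List.Membership.Propositional using (_∈_)
open import Data.List.Relation.Unary.Any using (here; there)
open import Data.Vec using (tabulate; toList)
open import Data.Product using (_×_; _,_; proj₁; proj₂; ∃-syntax)
open import Data.Sum using (_⊎_; inj₁; inj₂; [_,_])
open import Data.Empty using (⊥-elim)
open import Relation.Nullary using (¬_; yes; no)
open import Relation.Binary using (tri<; tri≈; tri>)
open import Relation.Binary.PropositionalEquality using (_≡_; _≢_; refl; sym; trans; cong; subst)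
open import Function using (_∘_; Injective)
open import Function.Bundles using (_⇔_; mk⇔; Equivalence)

Crossing : (ℕ × ℕ → Set) → Set
Crossing P = ∃[ a ] ∃[ b ] ∃[ c ] ∃[ d ] P (a , b) × P (c , d) × a < c × d < b

crossing-mono : {P Q : ℕ × ℕ → Set} → (∀ {a b} → P (a , b) → Q (a , b)) → Crossing P → Crossing Q
crossing-mono P⊆Q (a , b , c , d , ab , cd , a<c , d<b) = a , b , c , d , P⊆Q ab , P⊆Q cd , a<c , d<b

OneToOne : (ℕ × ℕ → Set) → Set
OneToOne P = ∀ {a b c d} → P (a , b) → P (c , d) → (a ≡ c → b ≡ d) × (b ≡ d → a ≡ c)

module _ {P : ℕ × ℕ → Set} (oneToOne : OneToOne P) (noCrossing : ¬ Crossing P) where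

  nonCrossing-monotone : ∀ {a b c d} → P (a , b) → P (c , d) → a < c → b < d
  nonCrossing-monotone {a} {b} {c} {d} ab cd a<c with <-cmp b d
  ... | tri< b<d _ _ = b<d
  ... | tri≈ _ b≡d _ = ⊥-elim (<-irrefl (proj₂ (oneToOne ab cd) b≡d) a<c)
  ... | tri> _ _ d<b = ⊥-elim (noCrossing (a , b , c , d , ab , cd , a<c , d<b))

  nonCrossing-reflects : ∀ {a b c d} → P (a , b) → P (c , d) → b < d → a < c
  nonCrossing-reflects {a} {c = c} ab cd b<d with <-cmp a c
  ... | tri< a<c _ _ = a<c
  ... | tri≈ _ a≡c _ = ⊥-elim (<-irrefl (proj₁ (oneToOne ab cd) a≡c) b<d)
  ... | tri> _ _ c<a = ⊥-elim (<-asym b<d (nonCrossing-monotone cd ab c<a))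

lookup-∈ : (ds : List (ℕ × ℕ)) (e : length (map proj₁ ds) ≡ length (map proj₂ ds))
  (s : Fin (length (map proj₁ ds))) → (lookup (map proj₁ ds) s , lookup (map proj₂ ds) (cast e s)) ∈ ds
lookup-∈ (_ ∷ ds) e fzero = here refl
lookup-∈ (_ ∷ ds) e (fsuc s) = there (lookup-∈ ds (suc-injective e) s)

∈⇒lookup : {ds : List (ℕ × ℕ)} (e : length (map proj₁ ds) ≡ length (map proj₂ ds)) {a b : ℕ} →
  (a , b) ∈ ds → ∃[ s ] lookup (map proj₁ ds) s ≡ a × lookup (map proj₂ ds) (cast e s) ≡ b
∈⇒lookup e (here refl) = fzero , refl , refl
∈⇒lookup e (there ab) with ∈⇒lookup (suc-injective e) ab
... | s , first , second = fsuc s , first , second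

orderIsomorphic⇔nonCrossing : (ds : List (ℕ × ℕ)) → OneToOne (_∈ ds) →
  OrderIsomorphic (map proj₁ ds) (map proj₂ ds) ⇔ (¬ Crossing (_∈ ds))
orderIsomorphic⇔nonCrossing ds oneToOne = mk⇔ isoNonCrossing nonCrossingIso
  where
  isoNonCrossing : OrderIsomorphic (map proj₁ ds) (map proj₂ ds) → ¬ Crossing (_∈ ds)
  isoNonCrossing (e , iso) (_ , _ , _ , _ , ab , cd , a<c , d<b) with ∈⇒lookup e ab | ∈⇒lookup e cd
  ... | s , refl , refl | t , refl , refl = <-asym d<b (proj₁ (iso s t) a<c)

  sameLength : length (map proj₁ ds) ≡ length (map proj₂ ds)
  sameLength = trans (length-map proj₁ ds) (sym (length-map proj₂ ds))

  nonCrossingIso : ¬ Crossing (_∈ ds) → OrderIsomorphic (map proj₁ ds) (map proj₂ ds)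
  nonCrossingIso noCrossing = sameLength , λ s t →
      nonCrossing-monotone oneToOne noCrossing (member s) (member t)
    , nonCrossing-reflects oneToOne noCrossing (member s) (member t)
    where
    member : (s : Fin (length (map proj₁ ds))) →
      (lookup (map proj₁ ds) s , lookup (map proj₂ ds) (cast sameLength s)) ∈ ds
    member = lookup-∈ ds sameLength

Descent : ∀ {n} → (Fin n → ℕ) → ℕ × ℕ → Set
Descent g (a , b) = ∃[ i ] ∃[ i' ] toℕ i' ≡ suc (toℕ i) × g i ≡ a × g i' ≡ b × b < a

descent-suc : ∀ {n} {g : Fin (suc n) → ℕ} {a b} → Descent (g ∘ fsuc) (a , b) → Descent g (a , b)
descent-suc (i , i' , adjacent , ga , gb , b<a) = fsuc i , fsuc i' , cong suc adjacent , ga , gb , b<a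

descentsFrom-sound : ∀ {n} (g : Fin (suc n) → ℕ) {a b} →
  (a , b) ∈ descentsFrom (g fzero) (toList (tabulate (g ∘ fsuc))) → Descent g (a , b)
descentsFrom-sound {zero} g ()
descentsFrom-sound {suc n} g ab with g (fsuc fzero) <? g fzero
descentsFrom-sound {suc n} g (here refl) | yes g1<g0 = fzero , fsuc fzero , refl , refl , refl , g1<g0
descentsFrom-sound {suc n} g (there ab) | yes _ = descent-suc (descentsFrom-sound (g ∘ fsuc) ab)
descentsFrom-sound {suc n} g ab | no _ = descent-suc (descentsFrom-sound (g ∘ fsuc) ab)

descentsFrom-complete : ∀ {n} (g : Fin (suc n) → ℕ) {a b} →
  Descent g (a , b) → (a , b) ∈ descentsFrom (g fzero) (toList (tabulate (g ∘ fsuc)))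
descentsFrom-complete {zero} g (fzero , fzero , () , _)
descentsFrom-complete {suc n} g (fzero , fzero , () , _)
descentsFrom-complete {suc n} g (fzero , fsuc (fsuc _) , () , _)
descentsFrom-complete {suc n} g (fzero , fsuc fzero , refl , refl , refl , g1<g0) with g (fsuc fzero) <? g fzero
... | yes _ = here refl
... | no g1≮g0 = ⊥-elim (g1≮g0 g1<g0)
descentsFrom-complete {suc n} g (fsuc i , fsuc i' , adjacent , ga , gb , b<a) with g (fsuc fzero) <? g fzero
... | yes _ = there later
  where later = descentsFrom-complete (g ∘ fsuc) (i , i' , suc-injective adjacent , ga , gb , b<a)
... | no _ = descentsFrom-complete (g ∘ fsuc) (i , i' , suc-injective adjacent , ga , gb , b<a)

descentPairs-sound : ∀ {n} (g : Fin n → ℕ) {a b} →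
  (a , b) ∈ descentPairs (toList (tabulate g)) → Descent g (a , b)
descentPairs-sound {zero} g ()
descentPairs-sound {suc n} g = descentsFrom-sound g

descentPairs-complete : ∀ {n} (g : Fin n → ℕ) {a b} →
  Descent g (a , b) → (a , b) ∈ descentPairs (toList (tabulate g))
descentPairs-complete {zero} g (() , _)
descentPairs-complete {suc n} g = descentsFrom-complete g

-- The descents of an injective sequence form a one-to-one relation: equal
-- initiators, or equal terminators, occupy the same positions.
descent-oneToOne : ∀ {n} {g : Fin n → ℕ} → Injective _≡_ _≡_ g → OneToOne (Descent g)
descent-oneToOne {g = g} injective (i , i' , adjI , refl , refl , _) (j , j' , adjJ , refl , refl , _) =
  (λ gi≡gj → cong g (sameNext (injective gi≡gj))) , (λ gi'≡gj' → cong g (samePrevious (injective gi'≡gj')))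
  where
  sameNext : i ≡ j → i' ≡ j'
  sameNext refl = toℕ-injective (trans adjI (sym adjJ))
  samePrevious : i' ≡ j' → i ≡ j
  samePrevious refl = toℕ-injective (suc-injective (trans (sym adjI) adjJ))

value : ∀ {n} → Perm n → Fin n → ℕ
value p = toℕ ∘ fun p

contains⇒crossing : ∀ {n} (p : Perm n) → Contains32-41 p ⊎ Contains41-32 p → Crossing (Descent (value p))
contains⇒crossing p (inj₁ (i , i' , j , j' , adjI , adjJ , _ , d<b , b<a , a<c)) =
  _ , _ , _ , _ , (i , i' , adjI , refl , refl , b<a)
  , (j , j' , adjJ , refl , refl , <-trans d<b (<-trans b<a a<c)) , a<c , d<b
contains⇒crossing p (inj₂ (i , i' , j , j' , adjI , adjJ , _ , b<d , d<c , c<a)) =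
  _ , _ , _ , _ , (j , j' , adjJ , refl , refl , d<c)
  , (i , i' , adjI , refl , refl , <-trans b<d (<-trans d<c c<a)) , c<a , b<d

nonAdjacent : ∀ {i j} → i < j → j ≢ suc i → i + 2 ≤ j
nonAdjacent {i} {j} i<j j≢1+i = subst (_≤ j) (+-comm 2 i) (≤∧≢⇒< i<j (j≢1+i ∘ sym))

value-cong : ∀ {n} (p : Perm n) {k l : Fin n} → toℕ k ≡ toℕ l → value p k ≡ value p l
value-cong p = cong (value p) ∘ toℕ-injective

-- Two crossing descents form one of the patterns: 32-41 if the descent with
-- the smaller initiator comes first, 41-32 if it comes second.  They are not
-- at the same position (their initiators differ) nor adjacent (the middle
-- entry would be both a terminator and an initiator).
crossing⇒contains : ∀ {n} (p : Perm n) → Crossing (Descent (value p)) → Contains32-41 p ⊎ Contains41-32 p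
crossing⇒contains p (_ , _ , _ , _ , (i , i' , adjI , refl , refl , b<a) , (j , j' , adjJ , refl , refl , _) , a<c , d<b)
  with <-cmp (toℕ i) (toℕ j)
... | tri≈ _ i≡j _ = ⊥-elim (<-irrefl (value-cong p i≡j) a<c)
... | tri< i<j _ _ = inj₁ (i , i' , j , j' , adjI , adjJ , nonAdjacent i<j consecutive , d<b , b<a , a<c)
  where consecutive : toℕ j ≢ suc (toℕ i)
        consecutive j≡1+i = <-asym b<a (subst (value p i <_) (value-cong p (trans j≡1+i (sym adjI))) a<c)
... | tri> _ _ j<i = inj₂ (j , j' , i , i' , adjJ , adjI , nonAdjacent j<i consecutive , d<b , b<a , a<c)
  where consecutive : toℕ i ≢ suc (toℕ j)
        consecutive i≡1+j = <-irrefl (value-cong p (trans adjJ (sym i≡1+j))) (<-trans d<b b<a)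

avoids⇔nonCrossing : ∀ {n} (p : Perm n) →
  ((¬ Contains32-41 p) × (¬ Contains41-32 p)) ⇔ (¬ Crossing (Descent (value p)))
avoids⇔nonCrossing p = mk⇔
  (λ (avoid32-41 , avoid41-32) → [ avoid32-41 , avoid41-32 ] ∘ crossing⇒contains p)
  (λ noCrossing → noCrossing ∘ contains⇒crossing p ∘ inj₁ , noCrossing ∘ contains⇒crossing p ∘ inj₂)

proposition1 : (n : ℕ) (p : Perm n) →
    ((¬ Contains32-41 p) × (¬ Contains41-32 p))
      ⇔ OrderIsomorphic (descentInitiators p) (descentTerminators p)
proposition1 n p = mk⇔
  (λ avoids → from listCriterion (noCrossingInList (to (avoids⇔nonCrossing p) avoids)))
  (λ iso → from (avoids⇔nonCrossing p) (noCrossingInDescents (to listCriterion iso)))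
  where
  open Equivalence
  listCriterion : OrderIsomorphic (descentInitiators p) (descentTerminators p)
                    ⇔ (¬ Crossing (_∈ descentPairs (word p)))
  listCriterion = orderIsomorphic⇔nonCrossing (descentPairs (word p))
    (λ ab cd → descent-oneToOne (inj p ∘ toℕ-injective)
                 (descentPairs-sound (value p) ab) (descentPairs-sound (value p) cd))
  noCrossingInList : ¬ Crossing (Descent (value p)) → ¬ Crossing (_∈ descentPairs (word p))
  noCrossingInList noCrossing = noCrossing ∘ crossing-mono (descentPairs-sound (value p))
  noCrossingInDescents : ¬ Crossing (_∈ descentPairs (word p)) → ¬ Crossing (Descent (value p))
  noCrossingInDescents noCrossing = noCrossing ∘ crossing-mono (descentPairs-complete (value p))
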